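{- Let $\mathcal{C}:\mathbb{R}^2\to\mathbb{R}$ be a commutative and associative cost function. Let $\alpha,\beta,\gamma$ be multi computer-controlled systems $$\alpha\equiv\big(\{x'=\theta_x,\ t'=1\,\&\,H_x\wedge\textstyle\bigwedge_{1\le i\le n_\alpha}t\le\tau_i+\delta_\alpha\}\cup\mathbf{MRCtrl}(\bigcup_{1\le i\le n_\alpha}\alpha_i,\delta_\alpha)\big)^*,$$ $$\beta\equiv\big(\{y'=\theta_y,\ t'=1\,\&\,H_y\wedge\textstyle\bigwedge_{1\le j\le n_\beta}t\le\tau_j+\delta_\beta\}\cup\mathbf{MRCtrl}(\bigcup_{1\le j\le n_\beta}\beta_j,\delta_\beta)\big)^*,$$ $$\gamma\equiv\big(\{z'=\theta_z,\ t'=1\,\&\,H_z\wedge\textstyle\bigwedge_{1\le k\le n_\gamma}t\le\tau_k+\delta_\gamma\}\cup\mathbf{MRCtrl}(\bigcup_{1\le k\le n_\gamma}\gamma_k,\delta_\gamma)\big)^*.$$ Then $\alpha\parallel\beta=\beta\parallel\alpha$ and $(\alpha\parallel\beta)\parallel\gamma=\alpha\parallel(\beta\parallel\gamma)$, where hybrid programs are identified up to commutativity and associativity of $\cup$, of the listing ``,'' of ODE equations and of conjunction.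
   Context: Hybrid programs (differential dynamic logic) use tests $?\varphi$, assignments, ODEs $\{x'=\theta\,\&\,H\}$, $;$, $\cup$, $^*$; $t$ is a global clock. $\mathbf{RCtrl}(\textit{ctrl},\delta)\equiv(?\,t\le\tau+\delta;\ \textit{ctrl};\ \tau:=t)$ with fresh $\tau$, and $\mathbf{MRCtrl}(\bigcup_{1\le i\le n}\textit{ctrl}_i,\delta)\equiv\bigcup_{1\le i\le n}\mathbf{RCtrl}(\textit{ctrl}_i,\delta)$ with fresh timestamp $\tau_i$ for $\textit{ctrl}_i$. $\mathcal{C}$ combines reactivity bounds (e.g. $\max$ or $+$). For multi computer-controlled systems $\alpha$ (plant $\{x'=\theta\,\&\,H\}$, controllers $\alpha_i$, $1\le i\le n$, bound $\delta_\alpha$) and $\beta$ (plant $\{y'=\eta\,\&\,Q\}$, controllers $\beta_j$, $1\le j\le m$, bound $\delta_\beta$) as displayed in the claim, the parallel composition is $$\alpha\parallel\beta\equiv\Big(\mathbf{MRCtrl}(\textstyle\bigcup_i\alpha_i,\mathcal{C}(\delta_\alpha,\delta_\beta))\cup\mathbf{MRCtrl}(\bigcup_j\beta_j,\mathcal{C}(\delta_\alpha,\delta_\beta))\cup\{x'=\theta,\ y'=\eta,\ t'=1\,\&\,H\wedge Q\wedge\bigwedge_{i}t\le\tau_i+\mathcal{C}(\delta_\alpha,\delta_\beta)\wedge\bigwedge_j t\le\tau_j+\mathcal{C}(\delta_\alpha,\delta_\beta)\}\Big)^*.$$ -}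

module Defs where

open import Data.Nat using (ℕ)
open import Data.Product using (_×_; _,_)
open import Data.List using (List; _++_; [_])
open import Data.List.NonEmpty using (List⁺; foldr₁; _⁺++⁺_) renaming (map to map⁺)
open import Data.List.Relation.Binary.Permutation.Propositional using (_↭_)

data Term (V R : Set) : Set where
  var  : V → Term V R
  const : R → Term V R
  lit  : ℕ → Term V R
  _⊕_  : Term V R → Term V R → Term V R
  _⊗_  : Term V R → Term V R → Term V R
  ⊖_   : Term V R → Term V R

data Fml (V R : Set) : Set where
  tt   : Fml V R
  _≤ₜ_ : Term V R → Term V R → Fml V R
  _=ₜ_ : Term V R → Term V R → Fml V R
  _∧ᶠ_ : Fml V R → Fml V R → Fml V R
  _∨ᶠ_ : Fml V R → Fml V R → Fml V R
  ¬ᶠ_  : Fml V R → Fml V R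

-- Hybrid programs.  An ODE is a list of equations x' = θ plus a domain.
data HP (V R : Set) : Set where
  _≔_  : V → Term V R → HP V R
  ¿_   : Fml V R → HP V R
  ode  : List (V × Term V R) → Fml V R → HP V R
  _⨾_  : HP V R → HP V R → HP V R
  _∪ᵖ_ : HP V R → HP V R → HP V R
  _*   : HP V R → HP V R

data _≈ᶠ_ {V R : Set} : Fml V R → Fml V R → Set where
  refl   : ∀ {φ} → φ ≈ᶠ φ
  sym    : ∀ {φ ψ} → φ ≈ᶠ ψ → ψ ≈ᶠ φ
  trans  : ∀ {φ ψ χ} → φ ≈ᶠ ψ → ψ ≈ᶠ χ → φ ≈ᶠ χ
  ∧-comm : ∀ {φ ψ} → (φ ∧ᶠ ψ) ≈ᶠ (ψ ∧ᶠ φ)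
  ∧-assoc : ∀ {φ ψ χ} → ((φ ∧ᶠ ψ) ∧ᶠ χ) ≈ᶠ (φ ∧ᶠ (ψ ∧ᶠ χ))
  ∧-cong : ∀ {φ φ' ψ ψ'} → φ ≈ᶠ φ' → ψ ≈ᶠ ψ' → (φ ∧ᶠ ψ) ≈ᶠ (φ' ∧ᶠ ψ')
  ∨-cong : ∀ {φ φ' ψ ψ'} → φ ≈ᶠ φ' → ψ ≈ᶠ ψ' → (φ ∨ᶠ ψ) ≈ᶠ (φ' ∨ᶠ ψ')
  ¬-cong : ∀ {φ φ'} → φ ≈ᶠ φ' → (¬ᶠ φ) ≈ᶠ (¬ᶠ φ')

data _≈ᵖ_ {V R : Set} : HP V R → HP V R → Set where
  refl    : ∀ {a} → a ≈ᵖ a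
  sym     : ∀ {a b} → a ≈ᵖ b → b ≈ᵖ a
  trans   : ∀ {a b c} → a ≈ᵖ b → b ≈ᵖ c → a ≈ᵖ c
  ∪-comm  : ∀ {a b} → (a ∪ᵖ b) ≈ᵖ (b ∪ᵖ a)
  ∪-assoc : ∀ {a b c} → ((a ∪ᵖ b) ∪ᵖ c) ≈ᵖ (a ∪ᵖ (b ∪ᵖ c))
  test-cong : ∀ {φ ψ} → φ ≈ᶠ ψ → (¿ φ) ≈ᵖ (¿ ψ)
  ode-cong  : ∀ {es es' φ ψ} → es ↭ es' → φ ≈ᶠ ψ → ode es φ ≈ᵖ ode es' ψ
  ⨾-cong  : ∀ {a a' b b'} → a ≈ᵖ a' → b ≈ᵖ b' → (a ⨾ b) ≈ᵖ (a' ⨾ b')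
  ∪-cong  : ∀ {a a' b b'} → a ≈ᵖ a' → b ≈ᵖ b' → (a ∪ᵖ b) ≈ᵖ (a' ∪ᵖ b')
  *-cong  : ∀ {a a'} → a ≈ᵖ a' → (a *) ≈ᵖ (a' *)

-- A multi computer-controlled system:
--   ( {plant, t'=1 & dom ∧ ⋀ᵢ t ≤ τᵢ + bound} ∪ MRCtrl(⋃ᵢ ctrlᵢ, bound) )*
-- Each controller comes with its own timestamp variable τᵢ; there is at
-- least one controller (1 ≤ i ≤ n).
record MCCS (V R : Set) : Set where
  constructor mccs
  field
    plant : List (V × Term V R)
    dom   : Fml V R
    ctrls : List⁺ (V × HP V R)
    bound : R
open MCCS public

module _ {V R : Set} (t : V) where

  RCtrl : R → V × HP V R → HP V R
  RCtrl δ (τ , c) = (¿ (var t ≤ₜ (var τ ⊕ const δ))) ⨾ (c ⨾ (τ ≔ var t))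

  MRCtrl : R → List⁺ (V × HP V R) → HP V R
  MRCtrl δ cs = foldr₁ _∪ᵖ_ (map⁺ (RCtrl δ) cs)

  Bounds : R → List⁺ (V × HP V R) → Fml V R
  Bounds δ cs = foldr₁ _∧ᶠ_ (map⁺ (λ p → var t ≤ₜ (var (Data.Product.proj₁ p) ⊕ const δ)) cs)

  ⟦_⟧ : MCCS V R → HP V R
  ⟦ S ⟧ = (ode (plant S ++ [ t , lit 1 ]) (dom S ∧ᶠ Bounds (bound S) (ctrls S))
           ∪ᵖ MRCtrl (bound S) (ctrls S)) *

  module _ (𝒞 : R → R → R) where

    par : MCCS V R → MCCS V R → HP V R
    par α β =
      ((MRCtrl d (ctrls α) ∪ᵖ MRCtrl d (ctrls β))
       ∪ᵖ ode (plant α ++ plant β ++ [ t , lit 1 ])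
              (dom α ∧ᶠ (dom β ∧ᶠ (Bounds d (ctrls α) ∧ᶠ Bounds d (ctrls β))))) *
      where d = 𝒞 (bound α) (bound β)

    -- α ∥ β viewed again as a multi computer-controlled system
    -- (plant x,y; domain H ∧ Q; controllers αᵢ and βⱼ; bound 𝒞(δα,δβ)).
    parSys : MCCS V R → MCCS V R → MCCS V R
    parSys α β = mccs (plant α ++ plant β) (dom α ∧ᶠ dom β)
                      (ctrls α ⁺++⁺ ctrls β) (𝒞 (bound α) (bound β))

-- Folding a semigroup operation over a concatenation of controller lists splits
-- into the two folds, so the controller unions and the bound conjunctions
-- reassociate; the ODE equations agree up to a permutation; and the only
-- genuine difference, the reactivity bound, is removed by commutativity and
-- associativity of 𝒞.
module Submission where

open import Defs
open import Data.Product using (_×_; _,_; proj₁)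
open import Data.List using ([]; _∷_; _++_; [_])
open import Data.List.NonEmpty using (List⁺; _∷_; foldr₁; _⁺++⁺_) renaming (map to map⁺)
open import Data.List.Properties using (++-assoc)
open import Data.List.Relation.Binary.Permutation.Propositional using (_↭_; ↭-reflexive)
open import Data.List.Relation.Binary.Permutation.Propositional.Properties using (shifts)
open import Algebra.Bundles using (Semigroup; CommutativeSemigroup)
open import Algebra.Definitions using (Commutative; Associative)
open import Algebra.Structures using (IsSemigroup; IsCommutativeSemigroup)
open import Relation.Binary.Structures using (IsEquivalence)
open import Relation.Binary.PropositionalEquality using (_≡_; cong; subst)
import Relation.Binary.PropositionalEquality as ≡
import Algebra.Properties.CommutativeSemigroup as CommutativeSemigroupProperties
import Relation.Binary.Reasoning.Setoid as SetoidReasoning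

module _ {c ℓ} (S : Semigroup c ℓ) where
  open Semigroup S using (Carrier; _≈_; _∙_; ∙-cong; assoc)
    renaming (refl to ≈-refl; sym to ≈-sym; trans to ≈-trans)

  foldr₁-map-⁺++⁺ : ∀ {A : Set} (g : A → Carrier) (xs ys : List⁺ A) →
    foldr₁ _∙_ (map⁺ g (xs ⁺++⁺ ys)) ≈ foldr₁ _∙_ (map⁺ g xs) ∙ foldr₁ _∙_ (map⁺ g ys)
  foldr₁-map-⁺++⁺ g (x ∷ xs) ys = go x xs
    where
    go : ∀ x xs → foldr₁ _∙_ (map⁺ g ((x ∷ xs) ⁺++⁺ ys))
                ≈ foldr₁ _∙_ (map⁺ g (x ∷ xs)) ∙ foldr₁ _∙_ (map⁺ g ys)
    go x []       = ≈-refl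
    go x (z ∷ zs) = ≈-trans (∙-cong ≈-refl (go z zs)) (≈-sym (assoc _ _ _))

module _ {V R : Set} where

  ≈ᶠ-isEquivalence : IsEquivalence (_≈ᶠ_ {V} {R})
  ≈ᶠ-isEquivalence = record { refl = refl ; sym = sym ; trans = trans }

  ≈ᵖ-isEquivalence : IsEquivalence (_≈ᵖ_ {V} {R})
  ≈ᵖ-isEquivalence = record { refl = refl ; sym = sym ; trans = trans }

  ∧-isCommutativeSemigroup : IsCommutativeSemigroup (_≈ᶠ_ {V} {R}) _∧ᶠ_
  ∧-isCommutativeSemigroup = record
    { isSemigroup = record
      { isMagma = record { isEquivalence = ≈ᶠ-isEquivalence ; ∙-cong = ∧-cong }
      ; assoc   = λ _ _ _ → ∧-assoc
      }
    ; comm = λ _ _ → ∧-comm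
    }

  ∧-commutativeSemigroup : CommutativeSemigroup _ _
  ∧-commutativeSemigroup = record { isCommutativeSemigroup = ∧-isCommutativeSemigroup }

  open CommutativeSemigroup ∧-commutativeSemigroup using ()
    renaming (semigroup to ∧-semigroup; setoid to ≈ᶠ-setoid)
  open CommutativeSemigroupProperties ∧-commutativeSemigroup using (x∙yz≈y∙xz)

  ∪-isSemigroup : IsSemigroup (_≈ᵖ_ {V} {R}) _∪ᵖ_
  ∪-isSemigroup = record
    { isMagma = record { isEquivalence = ≈ᵖ-isEquivalence ; ∙-cong = ∪-cong }
    ; assoc   = λ _ _ _ → ∪-assoc
    }

  ∪-semigroup : Semigroup _ _
  ∪-semigroup = record { isSemigroup = ∪-isSemigroup }

  module _ (t : V) where

    MRCtrl-⁺++⁺ : ∀ d cs ds → MRCtrl t d (cs ⁺++⁺ ds) ≈ᵖ (MRCtrl t d cs ∪ᵖ MRCtrl t d ds)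
    MRCtrl-⁺++⁺ d = foldr₁-map-⁺++⁺ ∪-semigroup (RCtrl t d)

    Bounds-⁺++⁺ : ∀ d cs ds → Bounds t d (cs ⁺++⁺ ds) ≈ᶠ (Bounds t d cs ∧ᶠ Bounds t d ds)
    Bounds-⁺++⁺ d = foldr₁-map-⁺++⁺ ∧-semigroup (λ p → var t ≤ₜ (var (proj₁ p) ⊕ const d))

    -- par t 𝒞 α β unfolds definitionally to parAt (𝒞 (bound α) (bound β)) α β.
    parAt : R → MCCS V R → MCCS V R → HP V R
    parAt d α β =
      ((MRCtrl t d (ctrls α) ∪ᵖ MRCtrl t d (ctrls β))
       ∪ᵖ ode (plant α ++ plant β ++ [ t , lit 1 ])
              (dom α ∧ᶠ (dom β ∧ᶠ (Bounds t d (ctrls α) ∧ᶠ Bounds t d (ctrls β))))) *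

    parAt-comm : ∀ d α β → parAt d α β ≈ᵖ parAt d β α
    parAt-comm d α β = *-cong (∪-cong ∪-comm (ode-cong (shifts (plant α) (plant β)) dom-comm))
      where
      dom-comm : (dom α ∧ᶠ (dom β ∧ᶠ (Bounds t d (ctrls α) ∧ᶠ Bounds t d (ctrls β))))
              ≈ᶠ (dom β ∧ᶠ (dom α ∧ᶠ (Bounds t d (ctrls β) ∧ᶠ Bounds t d (ctrls α))))
      dom-comm = trans (x∙yz≈y∙xz _ _ _) (∧-cong refl (∧-cong refl ∧-comm))

    -- parAt ignores the bound field, so the inner parSys may use any 𝒞.
    parAt-assoc : ∀ 𝒞 d α β γ → parAt d (parSys t 𝒞 α β) γ ≈ᵖ parAt d α (parSys t 𝒞 β γ)
    parAt-assoc 𝒞 d α β γ = *-cong (∪-cong ctrls-assoc (ode-cong plants-assoc dom-assoc))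
      where
      open SetoidReasoning ≈ᶠ-setoid
      Bα Bβ Bγ : Fml V R
      Bα = Bounds t d (ctrls α)
      Bβ = Bounds t d (ctrls β)
      Bγ = Bounds t d (ctrls γ)

      ctrls-assoc : (MRCtrl t d (ctrls α ⁺++⁺ ctrls β) ∪ᵖ MRCtrl t d (ctrls γ))
                 ≈ᵖ (MRCtrl t d (ctrls α) ∪ᵖ MRCtrl t d (ctrls β ⁺++⁺ ctrls γ))
      ctrls-assoc = trans (∪-cong (MRCtrl-⁺++⁺ d (ctrls α) (ctrls β)) refl)
                   (trans ∪-assoc (∪-cong refl (sym (MRCtrl-⁺++⁺ d (ctrls β) (ctrls γ)))))

      plants-assoc : ((plant α ++ plant β) ++ plant γ ++ [ t , lit 1 ])
                  ↭ (plant α ++ (plant β ++ plant γ) ++ [ t , lit 1 ])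
      plants-assoc = ↭-reflexive (≡.trans (++-assoc (plant α) (plant β) (plant γ ++ [ t , lit 1 ]))
                                          (cong (plant α ++_) (≡.sym (++-assoc (plant β) (plant γ) _))))

      dom-assoc : ((dom α ∧ᶠ dom β) ∧ᶠ (dom γ ∧ᶠ (Bounds t d (ctrls α ⁺++⁺ ctrls β) ∧ᶠ Bγ)))
               ≈ᶠ (dom α ∧ᶠ ((dom β ∧ᶠ dom γ) ∧ᶠ (Bα ∧ᶠ Bounds t d (ctrls β ⁺++⁺ ctrls γ))))
      dom-assoc = begin
        (dom α ∧ᶠ dom β) ∧ᶠ (dom γ ∧ᶠ (Bounds t d (ctrls α ⁺++⁺ ctrls β) ∧ᶠ Bγ))
          ≈⟨ ∧-cong refl (∧-cong refl (∧-cong (Bounds-⁺++⁺ d (ctrls α) (ctrls β)) refl)) ⟩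
        (dom α ∧ᶠ dom β) ∧ᶠ (dom γ ∧ᶠ ((Bα ∧ᶠ Bβ) ∧ᶠ Bγ))
          ≈⟨ ∧-cong refl (∧-cong refl ∧-assoc) ⟩
        (dom α ∧ᶠ dom β) ∧ᶠ (dom γ ∧ᶠ (Bα ∧ᶠ (Bβ ∧ᶠ Bγ)))
          ≈⟨ trans ∧-assoc (∧-cong refl (sym ∧-assoc)) ⟩
        dom α ∧ᶠ ((dom β ∧ᶠ dom γ) ∧ᶠ (Bα ∧ᶠ (Bβ ∧ᶠ Bγ)))
          ≈⟨ ∧-cong refl (∧-cong refl (∧-cong refl (sym (Bounds-⁺++⁺ d (ctrls β) (ctrls γ))))) ⟩
        dom α ∧ᶠ ((dom β ∧ᶠ dom γ) ∧ᶠ (Bα ∧ᶠ Bounds t d (ctrls β ⁺++⁺ ctrls γ))) ∎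

proposition3 : {V R : Set} (𝒞 : R → R → R)
    → Commutative _≡_ 𝒞 → Associative _≡_ 𝒞
    → (t : V) (α β γ : MCCS V R)
    → (par t 𝒞 α β ≈ᵖ par t 𝒞 β α)
    × (par t 𝒞 (parSys t 𝒞 α β) γ ≈ᵖ par t 𝒞 α (parSys t 𝒞 β γ))
proposition3 {R = R} 𝒞 comm assoc t α β γ =
    subst (λ d → parAt t (𝒞 a b) α β ≈ᵖ parAt t d β α) (comm a b)
          (parAt-comm t (𝒞 a b) α β)
  , subst (λ d → parAt t (𝒞 (𝒞 a b) c) (parSys t 𝒞 α β) γ ≈ᵖ parAt t d α (parSys t 𝒞 β γ))
          (assoc a b c)
          (parAt-assoc t 𝒞 (𝒞 (𝒞 a b) c) α β γ)
  where
  a b c : R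
  a = bound α
  b = bound β
  c = bound γ
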